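{- Let $r\ge 2$, $k\ge 1$ and $n\ge 2r$ be integers, and let $G_n$ be the graph with vertex set $\{(i,X) : 1\le i\le k,\ X\subseteq[n],\ |X|=r\}$, where $(i,X)$ and $(j,Y)$ are adjacent iff either $i=j$ and $X\cap Y=\emptyset$, or $i\ne j$ and $X\cap Y\ne\emptyset$. For an ordered partition $\mathcal S=(S_1,\dots,S_k)$ of $[n]$ into pairwise disjoint (possibly empty) sets, let $\alpha(\mathcal S)$ be the maximum size of an independent set of $G_n$ all of whose vertices $(i,X)$ satisfy $X\subseteq S_i$. Suppose $\mathcal S$ has at least two nonempty parts, every nonempty part has at least $2r-1$ elements, and $|S_i|\ge 2r$ for some $i$. Let $j\ne i$ with $S_j\ne\emptyset$, and let $\mathcal S'$ be obtained from $\mathcal S$ by replacing $S_i$ with $S_i\cup S_j$ and $S_j$ with $\emptyset$. Then $\alpha(\mathcal S')\ge\alpha(\mathcal S)$.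
   Context: $[n]=\{1,\dots,n\}$. An independent set is a set of pairwise non-adjacent vertices. -}

module Defs where

open import Data.Nat using (ℕ; _≤_; _*_; _∸_)
open import Data.Fin using (Fin; _≟_)
open import Data.Fin.Subset using (Subset; _∩_; Empty; Nonempty; _⊆_; ∣_∣)
open import Data.Vec using (tabulate)
open import Data.Product using (_×_; _,_; ∃; ∃₂)
open import Data.Sum using (_⊎_)
open import Data.List using (List; length)
open import Data.List.Relation.Unary.All using (All)
open import Data.List.Relation.Unary.AllPairs using (AllPairs)
open import Data.List.Relation.Unary.Unique.Propositional using (Unique)
open import Relation.Binary.PropositionalEquality using (_≡_; _≢_)
open import Relation.Nullary using (¬_; does; yes; no)

Vtx : ℕ → ℕ → Set
Vtx k n = Fin k × Subset n

IsVertex : ∀ {k n} → ℕ → Vtx k n → Set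
IsVertex r (i , X) = ∣ X ∣ ≡ r

Adj : ∀ {k n} → Vtx k n → Vtx k n → Set
Adj (i , X) (j , Y) = (i ≡ j × Empty (X ∩ Y)) ⊎ (i ≢ j × Nonempty (X ∩ Y))

-- An ordered partition (S_1,…,S_k) of [n] into pairwise disjoint, possibly empty
-- parts covering [n] is encoded by the map sending each element to its part index.
Partition : ℕ → ℕ → Set
Partition k n = Fin n → Fin k

part : ∀ {k n} → Partition k n → Fin k → Subset n
part S i = tabulate (λ x → does (S x ≟ i))

AdmissibleIndep : ∀ {k n} → ℕ → Partition k n → List (Vtx k n) → Set
AdmissibleIndep r S I =
  Unique I × All (IsVertex r) I × All (λ v → Data.Product.proj₂ v ⊆ part S (Data.Product.proj₁ v)) I
  × AllPairs (λ u v → ¬ Adj u v) I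

αLe : ∀ {k n} → ℕ → Partition k n → Partition k n → Set
αLe r S S' = ∀ I → AdmissibleIndep r S I →
  ∃ λ J → AdmissibleIndep r S' J × length I ≤ length J

merge : ∀ {k n} → Partition k n → Fin k → Fin k → Partition k n
merge S i j x with S x ≟ j
... | yes _ = i
... | no _ = S x

-- Vertices of different colours in an admissible set lie in disjoint parts, so such a set is a choice,
-- for every colour l, of an intersecting family of r-subsets of S_l. After the merge, the families of
-- colours i and j are replaced by the star at a point x ∈ S_i of all r-subsets of S_i ∪ S_j, which has
-- C(a+b-1, r-1) members for a = |S_i|, b = |S_j|. Erdős–Ko–Rado bounds the family on S_i by C(a-1, r-1);
-- the family on S_j has at most C(b, r-1) members (by Erdős–Ko–Rado if b ≥ 2r, by complementation if
-- b = 2r-1); and C(a-1, r-1) + C(b, r-1) ≤ C(a+b-1, r-1) as r ≥ 2. Erdős–Ko–Rado itself is proved by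
-- shifting away from the first point and induction on the ground set.
module Submission where

open import Defs
open import Function using (_∘_)
open import Data.Nat using (ℕ; zero; suc; _+_; _*_; _∸_; _≤_; _<_; z≤n; s≤s; _≡ᵇ_)
open import Data.Nat.Properties hiding (_≟_)
open import Data.Nat.Tactic.RingSolver using (solve-∀)
open import Algebra.Properties.CommutativeSemigroup +-commutativeSemigroup using (interchange)
open import Data.Bool using (Bool; true; false; _∧_; _∨_; not; _xor_; if_then_else_)
open import Data.Bool.Properties using (∧-zeroʳ; ∧-identityʳ; ∨-identityʳ; ∨-zeroʳ)
import Data.Bool.Properties as Bool
open import Data.Fin using (Fin; zero; suc; _≟_)
open import Data.Fin.Properties using (any?)
open import Data.Fin.Subset using (Subset; _∩_; Empty; Nonempty; _⊆_; ∣_∣)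
open import Data.Fin.Subset.Properties using (x∈p∩q⁻; x∈p∩q⁺; ∣p∣≤∣x∷p∣)
open import Data.Vec using ([]; _∷_; lookup; insertAt; _[_]≔_)
open import Data.Vec.Properties using (∷-injectiveʳ; lookup∘tabulate; []=⇒lookup; lookup⇒[]=; ≡-dec; lookup∘update; lookup∘update′; insertAt-lookup)
open import Data.List using (List; []; _∷_; length; map; _++_; removeAt)
open import Data.List.Properties using (length-++; length-map; length-removeAt′)
open import Data.List.Relation.Unary.All using (All; []; _∷_)
import Data.List.Relation.Unary.All as All
import Data.List.Relation.Unary.All.Properties as All
open import Data.List.Relation.Unary.Any using (here; there; index)
import Data.List.Relation.Unary.Any as Any
open import Data.List.Relation.Unary.AllPairs using (AllPairs; []; _∷_)
import Data.List.Relation.Unary.AllPairs.Properties as AllPairs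
open import Data.List.Relation.Unary.Unique.Propositional using (Unique)
import Data.List.Relation.Unary.Unique.Propositional.Properties as Unique
open import Data.List.Membership.Propositional using (_∈_)
open import Data.List.Membership.Propositional.Properties using (∈-map⁻; ∈-map⁺; ∈-++⁺ˡ; ∈-++⁺ʳ)
open import Data.Product using (_×_; _,_; ∃; ∃₂; Σ; proj₁; proj₂; map₁)
open import Data.Sum using (_⊎_; inj₁; inj₂)
open import Data.Empty using (⊥; ⊥-elim)
open import Relation.Nullary using (¬_; Dec; yes; no; does)
open import Relation.Nullary.Decidable using (dec-true; map′; _×-dec_; _⊎-dec_)
open import Relation.Binary.PropositionalEquality

true≢false : true ≢ false
true≢false ()

∧-true⁻ : ∀ {a b} → a ∧ b ≡ true → a ≡ true × b ≡ true
∧-true⁻ {true} {true} _ = refl , refl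

∨-true⁻ : ∀ {a b} → a ∨ b ≡ true → a ≡ true ⊎ b ≡ true
∨-true⁻ {true}  _ = inj₁ refl
∨-true⁻ {false} e = inj₂ e

≡ᵇ-true⁻ : ∀ m n → (m ≡ᵇ n) ≡ true → m ≡ n
≡ᵇ-true⁻ zero    zero    _ = refl
≡ᵇ-true⁻ (suc m) (suc n) e = cong suc (≡ᵇ-true⁻ m n e)

≡ᵇ-refl : ∀ m → (m ≡ᵇ m) ≡ true
≡ᵇ-refl zero    = refl
≡ᵇ-refl (suc m) = ≡ᵇ-refl m

bit : Bool → ℕ
bit true  = 1
bit false = 0

-- Subsets as bit vectors

_⊆ᵇ_ : ∀ {n} → Subset n → Subset n → Bool
[]      ⊆ᵇ []      = true
(x ∷ X) ⊆ᵇ (w ∷ W) = (not x ∨ w) ∧ (X ⊆ᵇ W)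

meets : ∀ {n} → Subset n → Subset n → Bool
meets []      []      = false
meets (x ∷ X) (y ∷ Y) = (x ∧ y) ∨ meets X Y

_Δ_ : ∀ {n} → Subset n → Subset n → Subset n
[]      Δ []      = []
(w ∷ W) Δ (x ∷ X) = (w xor x) ∷ (W Δ X)

⊆ᵇ-lookup : ∀ {n} (X W : Subset n) → X ⊆ᵇ W ≡ true → ∀ y → lookup X y ≡ true → lookup W y ≡ true
⊆ᵇ-lookup (true ∷ X) (true ∷ W) _   zero    _ = refl
⊆ᵇ-lookup (x ∷ X)    (w ∷ W)    X⊆W (suc y) = ⊆ᵇ-lookup X W (proj₂ (∧-true⁻ {not x ∨ w} X⊆W)) y

lookup-⊆ᵇ : ∀ {n} (X W : Subset n) → (∀ y → lookup X y ≡ true → lookup W y ≡ true) → X ⊆ᵇ W ≡ true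
lookup-⊆ᵇ []          []          _   = refl
lookup-⊆ᵇ (true ∷ X)  (true ∷ W)  X⊆W = lookup-⊆ᵇ X W (X⊆W ∘ suc)
lookup-⊆ᵇ (true ∷ X)  (false ∷ W) X⊆W = ⊥-elim (true≢false (sym (X⊆W zero refl)))
lookup-⊆ᵇ (false ∷ X) (w ∷ W)     X⊆W = lookup-⊆ᵇ X W (X⊆W ∘ suc)

⊆ᵇ⇒⊆ : ∀ {n} (X W : Subset n) → X ⊆ᵇ W ≡ true → X ⊆ W
⊆ᵇ⇒⊆ X W X⊆W {y} y∈X = lookup⇒[]= y W (⊆ᵇ-lookup X W X⊆W y ([]=⇒lookup y∈X))

⊆⇒⊆ᵇ : ∀ {n} (X W : Subset n) → X ⊆ W → X ⊆ᵇ W ≡ true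
⊆⇒⊆ᵇ X W X⊆W = lookup-⊆ᵇ X W (λ y y∈X → []=⇒lookup (X⊆W (lookup⇒[]= y X y∈X)))

meets-intro : ∀ {n} (X Y : Subset n) y → lookup X y ≡ true → lookup Y y ≡ true → meets X Y ≡ true
meets-intro (true ∷ X) (true ∷ Y) zero    refl refl = refl
meets-intro (x ∷ X)    (y ∷ Y)    (suc z) z∈X  z∈Y
  rewrite meets-intro X Y z z∈X z∈Y = ∨-zeroʳ (x ∧ y)

meets-elim : ∀ {n} (X Y : Subset n) → meets X Y ≡ true → ∃ λ y → lookup X y ≡ true × lookup Y y ≡ true
meets-elim []          []          ()
meets-elim (true ∷ X)  (true ∷ Y)  _ = zero , refl , refl
meets-elim (true ∷ X)  (false ∷ Y) e with meets-elim X Y e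
... | y , y∈X , y∈Y = suc y , y∈X , y∈Y
meets-elim (false ∷ X) (_ ∷ Y)     e with meets-elim X Y e
... | y , y∈X , y∈Y = suc y , y∈X , y∈Y

meets-sym : ∀ {n} (X Y : Subset n) → meets X Y ≡ true → meets Y X ≡ true
meets-sym X Y e with meets-elim X Y e
... | y , y∈X , y∈Y = meets-intro Y X y y∈Y y∈X

meets-self : ∀ {n} (X : Subset n) {m} → ∣ X ∣ ≡ suc m → meets X X ≡ true
meets-self (true ∷ X)  _ = refl
meets-self (false ∷ X) e = meets-self X e

meets-empty : ∀ {n} (X Y : Subset n) → ∣ X ∣ ≡ 0 → meets X Y ≡ false
meets-empty []          []      _ = refl
meets-empty (false ∷ X) (_ ∷ Y) e = meets-empty X Y e

empty-unique : ∀ {n} (X Y : Subset n) → ∣ X ∣ ≡ 0 → ∣ Y ∣ ≡ 0 → X ≡ Y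
empty-unique []          []          _ _ = refl
empty-unique (false ∷ X) (false ∷ Y) e f = cong (false ∷_) (empty-unique X Y e f)

meeting-singletons-≡ : ∀ {n} (X Y : Subset n) → ∣ X ∣ ≡ 1 → ∣ Y ∣ ≡ 1 → meets X Y ≡ true → X ≡ Y
meeting-singletons-≡ (true ∷ X)  (true ∷ Y)  e f _ = cong (true ∷_) (empty-unique X Y (suc-injective e) (suc-injective f))
meeting-singletons-≡ (true ∷ X)  (false ∷ Y) e _ m = ⊥-elim (true≢false (trans (sym m) (meets-empty X Y (suc-injective e))))
meeting-singletons-≡ (false ∷ X) (true ∷ Y)  _ f m =
  ⊥-elim (true≢false (trans (sym (meets-sym X Y m)) (meets-empty Y X (suc-injective f))))
meeting-singletons-≡ (false ∷ X) (false ∷ Y) e f m = cong (false ∷_) (meeting-singletons-≡ X Y e f m)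

Δ-disjoint : ∀ {n} (W G : Subset n) → G ⊆ᵇ W ≡ true → meets G (W Δ G) ≡ false
Δ-disjoint []          []          _   = refl
Δ-disjoint (true ∷ W)  (true ∷ G)  G⊆W = Δ-disjoint W G G⊆W
Δ-disjoint (true ∷ W)  (false ∷ G) G⊆W = Δ-disjoint W G G⊆W
Δ-disjoint (false ∷ W) (false ∷ G) G⊆W = Δ-disjoint W G G⊆W

Δ-⊆ᵇ⁻ : ∀ {n} (W G : Subset n) → (W Δ G) ⊆ᵇ W ≡ true → G ⊆ᵇ W ≡ true
Δ-⊆ᵇ⁻ []          []          _ = refl
Δ-⊆ᵇ⁻ (true ∷ W)  (true ∷ G)  s = Δ-⊆ᵇ⁻ W G s
Δ-⊆ᵇ⁻ (true ∷ W)  (false ∷ G) s = Δ-⊆ᵇ⁻ W G s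
Δ-⊆ᵇ⁻ (false ∷ W) (false ∷ G) s = Δ-⊆ᵇ⁻ W G s

∣Δ∣+∣∣ : ∀ {n} (W G : Subset n) → G ⊆ᵇ W ≡ true → ∣ W Δ G ∣ + ∣ G ∣ ≡ ∣ W ∣
∣Δ∣+∣∣ []          []          _   = refl
∣Δ∣+∣∣ (true ∷ W)  (true ∷ G)  G⊆W = trans (+-suc _ _) (cong suc (∣Δ∣+∣∣ W G G⊆W))
∣Δ∣+∣∣ (true ∷ W)  (false ∷ G) G⊆W = cong suc (∣Δ∣+∣∣ W G G⊆W)
∣Δ∣+∣∣ (false ∷ W) (false ∷ G) G⊆W = ∣Δ∣+∣∣ W G G⊆W

∣∣-covered : ∀ {n} (W G H : Subset n) → (∀ y → lookup W y ≡ true → (lookup G y ∨ lookup H y) ≡ true) →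
  ∣ W ∣ ≤ ∣ G ∣ + ∣ H ∣
∣∣-covered []          []          []          _   = z≤n
∣∣-covered (false ∷ W) (g ∷ G)     (h ∷ H)     cov =
  ≤-trans (∣∣-covered W G H (cov ∘ suc)) (+-mono-≤ (∣p∣≤∣x∷p∣ g G) (∣p∣≤∣x∷p∣ h H))
∣∣-covered (true ∷ W)  (true ∷ G)  (h ∷ H)     cov =
  s≤s (≤-trans (∣∣-covered W G H (cov ∘ suc)) (+-monoʳ-≤ ∣ G ∣ (∣p∣≤∣x∷p∣ h H)))
∣∣-covered (true ∷ W)  (false ∷ G) (true ∷ H)  cov =
  subst (suc ∣ W ∣ ≤_) (sym (+-suc ∣ G ∣ ∣ H ∣)) (s≤s (∣∣-covered W G H (cov ∘ suc)))
∣∣-covered (true ∷ W)  (false ∷ G) (false ∷ H) cov = ⊥-elim (true≢false (sym (cov zero refl)))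

∣∪∣ : ∀ {n} (U A B : Subset n) → (∀ y → lookup U y ≡ (lookup A y ∨ lookup B y)) →
  (∀ y → (lookup A y ∧ lookup B y) ≡ false) → ∣ U ∣ ≡ ∣ A ∣ + ∣ B ∣
∣∪∣ []      []      []      _ _ = refl
∣∪∣ (u ∷ U) (a ∷ A) (b ∷ B) U≡A∪B A∩B≡∅
  with U≡A∪B zero | A∩B≡∅ zero | ∣∪∣ U A B (U≡A∪B ∘ suc) (A∩B≡∅ ∘ suc)
... | refl | _ | e with a | b
...   | true  | false = cong suc e
...   | false | true  = trans (cong suc e) (sym (+-suc _ _))
...   | false | false = e

∣[]≔false∣ : ∀ {n} (X : Subset n) y → lookup X y ≡ true → ∣ X ∣ ≡ suc ∣ X [ y ]≔ false ∣
∣[]≔false∣ (true ∷ X)  zero    _ = refl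
∣[]≔false∣ (true ∷ X)  (suc y) e = cong suc (∣[]≔false∣ X y e)
∣[]≔false∣ (false ∷ X) (suc y) e = ∣[]≔false∣ X y e

insertAt-[]≔ : ∀ {n} (Z : Subset n) y (c d : Bool) → insertAt Z y c [ y ]≔ d ≡ insertAt Z y d
insertAt-[]≔ Z       zero    c d = refl
insertAt-[]≔ (z ∷ Z) (suc y) c d = cong (z ∷_) (insertAt-[]≔ Z y c d)

nonempty-lookup : ∀ {n} (W : Subset n) {m} → ∣ W ∣ ≡ suc m → ∃ λ x → lookup W x ≡ true
nonempty-lookup (true ∷ W)  _ = zero , refl
nonempty-lookup (false ∷ W) e with nonempty-lookup W e
... | x , x∈W = suc x , x∈W

lookup-nonempty : ∀ {n} (W : Subset n) x → lookup W x ≡ true → ∃ λ m → ∣ W ∣ ≡ suc m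
lookup-nonempty (true ∷ W)  _       _ = ∣ W ∣ , refl
lookup-nonempty (false ∷ W) (suc x) e = lookup-nonempty W x e

-- Counting families of subsets

Family : ℕ → Set
Family n = Subset n → Bool

count : ∀ {n} → Family n → ℕ
count {zero}  f = bit (f [])
count {suc n} f = count (f ∘ (true ∷_)) + count (f ∘ (false ∷_))

count-cong : ∀ {n} {f g : Family n} → (∀ X → f X ≡ g X) → count f ≡ count g
count-cong {zero}  f≗g = cong bit (f≗g [])
count-cong {suc n} f≗g = cong₂ _+_ (count-cong (f≗g ∘ (true ∷_))) (count-cong (f≗g ∘ (false ∷_)))

count-zero : ∀ {n} (f : Family n) → (∀ X → f X ≡ false) → count f ≡ 0
count-zero {zero}  f f≗∅ rewrite f≗∅ [] = refl
count-zero {suc n} f f≗∅ = cong₂ _+_ (count-zero _ (f≗∅ ∘ (true ∷_))) (count-zero _ (f≗∅ ∘ (false ∷_)))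

count-mono : ∀ {n} (f g : Family n) → (∀ X → f X ≡ true → g X ≡ true) → count f ≤ count g
count-mono {zero} f g f⊆g with f [] in e
... | false = z≤n
... | true rewrite f⊆g [] e = ≤-refl
count-mono {suc n} f g f⊆g = +-mono-≤ (count-mono _ _ (f⊆g ∘ (true ∷_))) (count-mono _ _ (f⊆g ∘ (false ∷_)))

count-mono-< : ∀ {n} (f g : Family n) → (∀ X → f X ≡ true → g X ≡ true) →
  ∀ X → f X ≡ false → g X ≡ true → count f < count g
count-mono-< {zero}  f g _   [] fX gX rewrite fX | gX = s≤s z≤n
count-mono-< {suc n} f g f⊆g (true ∷ X) fX gX =
  +-mono-<-≤ (count-mono-< _ _ (f⊆g ∘ (true ∷_)) X fX gX) (count-mono _ _ (f⊆g ∘ (false ∷_)))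
count-mono-< {suc n} f g f⊆g (false ∷ X) fX gX =
  +-mono-≤-< (count-mono _ _ (f⊆g ∘ (true ∷_))) (count-mono-< _ _ (f⊆g ∘ (false ∷_)) X fX gX)

count-+-≤ : ∀ {n} (f g h : Family n) → (∀ X → bit (f X) + bit (g X) ≤ bit (h X)) → count f + count g ≤ count h
count-+-≤ {zero}  f g h pointwise = pointwise []
count-+-≤ {suc n} f g h pointwise =
  subst (_≤ count h) (interchange (count (f ∘ (true ∷_))) (count (g ∘ (true ∷_))) _ _)
    (+-mono-≤ (count-+-≤ _ _ _ (pointwise ∘ (true ∷_))) (count-+-≤ _ _ _ (pointwise ∘ (false ∷_))))

count-+-≡ : ∀ {n} (f g f′ g′ : Family n) → (∀ X → bit (f X) + bit (g X) ≡ bit (f′ X) + bit (g′ X)) →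
  count f + count g ≡ count f′ + count g′
count-+-≡ {zero}  f g f′ g′ pointwise = pointwise []
count-+-≡ {suc n} f g f′ g′ pointwise = begin
  count f + count g
    ≡⟨ interchange (count (f ∘ (true ∷_))) _ (count (g ∘ (true ∷_))) _ ⟩
  (count (f ∘ (true ∷_)) + count (g ∘ (true ∷_))) + (count (f ∘ (false ∷_)) + count (g ∘ (false ∷_)))
    ≡⟨ cong₂ _+_ (count-+-≡ _ _ _ _ (pointwise ∘ (true ∷_))) (count-+-≡ _ _ _ _ (pointwise ∘ (false ∷_))) ⟩
  (count (f′ ∘ (true ∷_)) + count (g′ ∘ (true ∷_))) + (count (f′ ∘ (false ∷_)) + count (g′ ∘ (false ∷_)))
    ≡⟨ interchange (count (f′ ∘ (true ∷_))) _ (count (f′ ∘ (false ∷_))) _ ⟩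
  count f′ + count g′ ∎
  where open ≡-Reasoning

count-insertAt : ∀ {n} (f : Family (suc n)) y →
  count f ≡ count (λ Z → f (insertAt Z y true)) + count (λ Z → f (insertAt Z y false))
count-insertAt f zero = refl
count-insertAt {suc n} f (suc y) =
  trans (cong₂ _+_ (count-insertAt (f ∘ (true ∷_)) y) (count-insertAt (f ∘ (false ∷_)) y))
        (interchange (count (λ Z → f (true ∷ insertAt Z y true))) _ _ _)

count-Δ : ∀ {n} (W : Subset n) (f : Family n) → count (f ∘ (W Δ_)) ≡ count f
count-Δ []          f = refl
count-Δ (true ∷ W)  f = trans (cong₂ _+_ (count-Δ W (f ∘ (false ∷_))) (count-Δ W (f ∘ (true ∷_))))
                              (+-comm (count (f ∘ (false ∷_))) _)
count-Δ (false ∷ W) f = cong₂ _+_ (count-Δ W (f ∘ (true ∷_))) (count-Δ W (f ∘ (false ∷_)))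

members : ∀ {n} → Family n → List (Subset n)
members {zero}  f = if f [] then [] ∷ [] else []
members {suc n} f = map (true ∷_) (members (f ∘ (true ∷_))) ++ map (false ∷_) (members (f ∘ (false ∷_)))

length-members : ∀ {n} (f : Family n) → length (members f) ≡ count f
length-members {zero} f with f []
... | true  = refl
... | false = refl
length-members {suc n} f = begin
  length (members f)
    ≡⟨ length-++ (map (true ∷_) (members (f ∘ (true ∷_)))) ⟩
  length (map (true ∷_) (members (f ∘ (true ∷_)))) + length (map (false ∷_) (members (f ∘ (false ∷_))))
    ≡⟨ cong₂ _+_ (length-map (true ∷_) (members (f ∘ (true ∷_)))) (length-map (false ∷_) (members (f ∘ (false ∷_)))) ⟩
  length (members (f ∘ (true ∷_))) + length (members (f ∘ (false ∷_)))
    ≡⟨ cong₂ _+_ (length-members (f ∘ (true ∷_))) (length-members (f ∘ (false ∷_))) ⟩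
  count f ∎
  where open ≡-Reasoning

members-sound : ∀ {n} (f : Family n) → All (λ X → f X ≡ true) (members f)
members-sound {zero} f with f [] in e
... | true  = e ∷ []
... | false = []
members-sound {suc n} f =
  All.++⁺ (All.map⁺ (members-sound (f ∘ (true ∷_)))) (All.map⁺ (members-sound (f ∘ (false ∷_))))

members-complete : ∀ {n} (f : Family n) {X} → f X ≡ true → X ∈ members f
members-complete {zero}  f {[]} fX rewrite fX = here refl
members-complete {suc n} f {true ∷ X}  fX = ∈-++⁺ˡ (∈-map⁺ (true ∷_) (members-complete (f ∘ (true ∷_)) fX))
members-complete {suc n} f {false ∷ X} fX =
  ∈-++⁺ʳ (map (true ∷_) (members (f ∘ (true ∷_)))) (∈-map⁺ (false ∷_) (members-complete (f ∘ (false ∷_)) fX))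

members-unique : ∀ {n} (f : Family n) → Unique (members f)
members-unique {zero} f with f []
... | true  = [] ∷ []
... | false = []
members-unique {suc n} f =
  Unique.++⁺ (Unique.map⁺ ∷-injectiveʳ (members-unique (f ∘ (true ∷_))))
             (Unique.map⁺ ∷-injectiveʳ (members-unique (f ∘ (false ∷_)))) heads-differ
  where
  heads-differ : ∀ {X} → ¬ (X ∈ map (true ∷_) (members (f ∘ (true ∷_))) × X ∈ map (false ∷_) (members (f ∘ (false ∷_))))
  heads-differ (p , q) with ∈-map⁻ (true ∷_) p | ∈-map⁻ (false ∷_) q
  ... | _ , _ , refl | _ , _ , ()

module _ {A : Set} where

  ∈-removeAt : ∀ {x y : A} {ys} (x∈ys : x ∈ ys) → y ∈ ys → y ≢ x → y ∈ removeAt ys (index x∈ys)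
  ∈-removeAt (here refl) (here refl) y≢x = ⊥-elim (y≢x refl)
  ∈-removeAt (here refl) (there y∈ys) _  = y∈ys
  ∈-removeAt (there x∈ys) (here refl) _  = here refl
  ∈-removeAt (there x∈ys) (there y∈ys) y≢x = there (∈-removeAt x∈ys y∈ys y≢x)

  unique⊆⇒length≤ : ∀ {xs ys : List A} → Unique xs → All (_∈ ys) xs → length xs ≤ length ys
  unique⊆⇒length≤ [] [] = z≤n
  unique⊆⇒length≤ {ys = ys} (x≢xs ∷ xs!) (x∈ys ∷ xs⊆ys) =
    subst (suc _ ≤_) (sym (length-removeAt′ ys (index x∈ys)))
      (s≤s (unique⊆⇒length≤ xs! (All.zipWith (λ (y∈ys , x≢y) → ∈-removeAt x∈ys y∈ys (x≢y ∘ sym)) (xs⊆ys , x≢xs))))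

length≤count : ∀ {n} (f : Family n) {L} → Unique L → All (λ X → f X ≡ true) L → length L ≤ count f
length≤count f L! fL = subst (_ ≤_) (length-members f) (unique⊆⇒length≤ L! (All.map (members-complete f) fL))

count≤1 : ∀ {n} (f : Family n) → (∀ X Y → f X ≡ true → f Y ≡ true → X ≡ Y) → count f ≤ 1
count≤1 f f-subsingleton = subst (_≤ 1) (length-members f) (at-most-one (members-unique f) (members-sound f))
  where
  at-most-one : ∀ {L} → Unique L → All (λ X → f X ≡ true) L → length L ≤ 1
  at-most-one []                 _                  = z≤n
  at-most-one (_ ∷ [])           _                  = s≤s z≤n
  at-most-one ((X≢Y ∷ _) ∷ _) (fX ∷ fY ∷ _) = ⊥-elim (X≢Y (f-subsingleton _ _ fX fY))

-- Pascal's rule rather than Data.Nat.Combinatorics._C_: counts of families compute to it by recursion.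
_choose_ : ℕ → ℕ → ℕ
n     choose zero  = 1
zero  choose suc k = 0
suc n choose suc k = n choose k + n choose suc k

choose-mono-suc : ∀ n k → n choose k ≤ suc n choose k
choose-mono-suc n zero    = ≤-refl
choose-mono-suc n (suc k) = m≤n+m _ _

choose-mono-+ : ∀ m n k → n choose k ≤ (m + n) choose k
choose-mono-+ zero    n k = ≤-refl
choose-mono-+ (suc m) n k = ≤-trans (choose-mono-+ m n k) (choose-mono-suc (m + n) k)

choose-superadditive : ∀ m n k → m choose suc k + n choose suc k ≤ (m + n) choose suc k
choose-superadditive m zero    k = ≤-reflexive (trans (+-identityʳ _) (cong (_choose suc k) (sym (+-identityʳ m))))
choose-superadditive m (suc n) k = begin
  m choose suc k + (n choose k + n choose suc k)  ≡⟨ x+[y+z]≡y+[x+z] (m choose suc k) (n choose k) (n choose suc k) ⟩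
  n choose k + (m choose suc k + n choose suc k)  ≤⟨ +-mono-≤ (choose-mono-+ m n k) (choose-superadditive m n k) ⟩
  suc (m + n) choose suc k                        ≡⟨ cong (_choose suc k) (sym (+-suc m n)) ⟩
  (m + suc n) choose suc k                        ∎
  where
  open ≤-Reasoning
  x+[y+z]≡y+[x+z] : ∀ x y z → x + (y + z) ≡ y + (x + z)
  x+[y+z]≡y+[x+z] = solve-∀

ofSize : ∀ {n} → Subset n → ℕ → Family n
ofSize W r X = (∣ X ∣ ≡ᵇ r) ∧ X ⊆ᵇ W

ofSize-intro : ∀ {n} (W X : Subset n) {r} → ∣ X ∣ ≡ r → X ⊆ᵇ W ≡ true → ofSize W r X ≡ true
ofSize-intro W X refl X⊆W rewrite ≡ᵇ-refl ∣ X ∣ = X⊆W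

count-ofSize : ∀ {n} (W : Subset n) r → count (ofSize W r) ≡ ∣ W ∣ choose r
count-ofSize []          zero    = refl
count-ofSize []          (suc r) = refl
count-ofSize (true ∷ W)  zero    =
  trans (cong (_+ count (ofSize W zero)) (count-zero (ofSize (true ∷ W) zero ∘ (true ∷_)) (λ _ → refl)))
        (count-ofSize W zero)
count-ofSize (true ∷ W)  (suc r) = cong₂ _+_ (count-ofSize W r) (count-ofSize W (suc r))
count-ofSize (false ∷ W) r       =
  trans (cong (_+ count (ofSize W r)) (count-zero (ofSize (false ∷ W) r ∘ (true ∷_)) (λ _ → ∧-zeroʳ _)))
        (count-ofSize W r)

star : ∀ {n} → Subset n → ℕ → Fin n → Family n
star U r x X = (∣ X ∣ ≡ᵇ r) ∧ X ⊆ᵇ U ∧ lookup X x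

lookup-empty : ∀ {n} (X : Subset n) x → ∣ X ∣ ≡ 0 → lookup X x ≡ false
lookup-empty (false ∷ X) zero    _ = refl
lookup-empty (false ∷ X) (suc x) e = lookup-empty X x e

count-star-zero : ∀ {n} (U : Subset n) x → count (star U 0 x) ≡ 0
count-star-zero U x = count-zero (star U 0 x) empty
  where
  empty : ∀ X → star U 0 x X ≡ false
  empty X with ∣ X ∣ ≡ᵇ 0 in e
  ... | false = refl
  ... | true  = trans (cong (X ⊆ᵇ U ∧_) (lookup-empty X x (≡ᵇ-true⁻ _ _ e))) (∧-zeroʳ _)

count-star : ∀ {n} (U : Subset n) s x {m} → lookup U x ≡ true → ∣ U ∣ ≡ suc m → count (star U (suc s) x) ≡ m choose s
count-star (true ∷ U) s zero _ ∣U∣≡ = begin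
  count (star (true ∷ U) (suc s) zero ∘ (true ∷_)) + count (star (true ∷ U) (suc s) zero ∘ (false ∷_))
    ≡⟨ cong₂ _+_ (count-cong (λ X → cong ((∣ X ∣ ≡ᵇ s) ∧_) (∧-identityʳ (X ⊆ᵇ U))))
                 (count-zero (star (true ∷ U) (suc s) zero ∘ (false ∷_)) (λ X → trans (cong ((∣ X ∣ ≡ᵇ suc s) ∧_) (∧-zeroʳ _)) (∧-zeroʳ _))) ⟩
  count (ofSize U s) + 0
    ≡⟨ trans (+-identityʳ _) (count-ofSize U s) ⟩
  ∣ U ∣ choose s
    ≡⟨ cong (_choose s) (suc-injective ∣U∣≡) ⟩
  _ ∎
  where open ≡-Reasoning
count-star (true ∷ U) s (suc x) x∈U ∣U∣≡ with lookup-nonempty U x x∈U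
... | m , ∣U∣≡′ with refl ← trans (sym (suc-injective ∣U∣≡)) ∣U∣≡′ with s
...   | zero   = cong₂ _+_ (count-star-zero U x) (count-star U zero x x∈U ∣U∣≡′)
...   | suc s′ = cong₂ _+_ (count-star U s′ x x∈U ∣U∣≡′) (count-star U (suc s′) x x∈U ∣U∣≡′)
count-star (false ∷ U) s (suc x) x∈U ∣U∣≡ =
  cong₂ _+_ (count-zero (star (false ∷ U) (suc s) (suc x) ∘ (true ∷_)) (λ X → ∧-zeroʳ (∣ X ∣ ≡ᵇ s)))
            (count-star U s x x∈U ∣U∣≡)

-- The Erdős–Ko–Rado theorem

record UniformFamily {n} (W : Subset n) (r : ℕ) (f : Family n) : Set where
  field
    within  : ∀ X → f X ≡ true → X ⊆ᵇ W ≡ true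
    uniform : ∀ X → f X ≡ true → ∣ X ∣ ≡ r

record IntersectingFamily {n} (W : Subset n) (r : ℕ) (f : Family n) : Set where
  field
    uniformFamily : UniformFamily W r f
    intersecting  : ∀ X Y → f X ≡ true → f Y ≡ true → meets X Y ≡ true
  open UniformFamily uniformFamily public

tail-intersecting : ∀ {n w} {W : Subset n} {r f} → IntersectingFamily (w ∷ W) r f →
  IntersectingFamily W r (f ∘ (false ∷_))
tail-intersecting F = record
  { uniformFamily = record { within = λ X → within (false ∷ X) ; uniform = λ X → uniform (false ∷ X) }
  ; intersecting  = λ X Y → intersecting (false ∷ X) (false ∷ Y)
  }
  where open IntersectingFamily F

-- Complementation in W sends the p-sets of f to q-sets of W, and none of these lies in g.
cross-intersecting-bound : ∀ {n} (W : Subset n) p q (f g : Family n) → ∣ W ∣ ≡ p + q →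
  UniformFamily W p f → UniformFamily W q g → (∀ X Y → f X ≡ true → g Y ≡ true → meets X Y ≡ true) →
  count f + count g ≤ ∣ W ∣ choose q
cross-intersecting-bound W p q f g ∣W∣≡p+q F G cross = begin
  count f + count g             ≡⟨ cong (_+ count g) (sym (count-Δ W f)) ⟩
  count (f ∘ (W Δ_)) + count g  ≤⟨ count-+-≤ (f ∘ (W Δ_)) g (ofSize W q) pointwise ⟩
  count (ofSize W q)            ≡⟨ count-ofSize W q ⟩
  ∣ W ∣ choose q                ∎
  where
  open ≤-Reasoning
  module F = UniformFamily F
  module G = UniformFamily G

  complement-ofSize : ∀ Y → f (W Δ Y) ≡ true → ofSize W q Y ≡ true
  complement-ofSize Y fY = ofSize-intro W Y ∣Y∣≡q Y⊆W
    where
    Y⊆W = Δ-⊆ᵇ⁻ W Y (F.within (W Δ Y) fY)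
    ∣Y∣≡q : ∣ Y ∣ ≡ q
    ∣Y∣≡q = +-cancelˡ-≡ p _ _ (begin-equality
      p + ∣ Y ∣          ≡⟨ cong (_+ ∣ Y ∣) (sym (F.uniform (W Δ Y) fY)) ⟩
      ∣ W Δ Y ∣ + ∣ Y ∣  ≡⟨ ∣Δ∣+∣∣ W Y Y⊆W ⟩
      ∣ W ∣              ≡⟨ ∣W∣≡p+q ⟩
      p + q              ∎)

  pointwise : ∀ Y → bit (f (W Δ Y)) + bit (g Y) ≤ bit (ofSize W q Y)
  pointwise Y with f (W Δ Y) in fY | g Y in gY
  ... | false | false = z≤n
  ... | false | true  = subst (λ b → 1 ≤ bit b) (sym (ofSize-intro W Y (G.uniform Y gY) (G.within Y gY))) ≤-refl
  ... | true  | false = subst (λ b → 1 ≤ bit b) (sym (complement-ofSize Y fY)) ≤-refl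
  ... | true  | true  =
    ⊥-elim (true≢false (trans (sym (meets-sym (W Δ Y) Y (cross (W Δ Y) Y fY gY))) (Δ-disjoint W Y (G.within Y gY))))

-- Members containing 0 but not y have 0 exchanged for y, unless the exchanged set is already a member.
shift : ∀ {n} → Fin n → Family (suc n) → Family (suc n)
shift y f (true ∷ X)  = f (true ∷ X) ∧ (lookup X y ∨ f (false ∷ (X [ y ]≔ true)))
shift y f (false ∷ X) = f (false ∷ X) ∨ (lookup X y ∧ f (true ∷ (X [ y ]≔ false)))

count-shift : ∀ {m} (y : Fin (suc m)) (f : Family (suc (suc m))) → count (shift y f) ≡ count f
count-shift y f = begin
  count sT + count sF
    ≡⟨ cong₂ _+_ (count-insertAt sT y) (count-insertAt sF y) ⟩
  (count (sT ∘ with-y) + count (sT ∘ without-y)) + (count (sF ∘ with-y) + count (sF ∘ without-y))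
    ≡⟨ exchange (count (sT ∘ with-y)) (count (sT ∘ without-y)) (count (sF ∘ with-y)) (count (sF ∘ without-y))
                (count (fT ∘ without-y)) (count (fF ∘ with-y)) (count-+-≡ (sT ∘ without-y) (sF ∘ with-y) (fT ∘ without-y) (fF ∘ with-y) exchanged) ⟩
  (count (sT ∘ with-y) + count (fT ∘ without-y)) + (count (fF ∘ with-y) + count (sF ∘ without-y))
    ≡⟨ cong₂ (λ a d → (a + count (fT ∘ without-y)) + (count (fF ∘ with-y) + d))
             (count-cong kept-with-0) (count-cong kept-without-0) ⟩
  (count (fT ∘ with-y) + count (fT ∘ without-y)) + (count (fF ∘ with-y) + count (fF ∘ without-y))
    ≡⟨ sym (cong₂ _+_ (count-insertAt fT y) (count-insertAt fF y)) ⟩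
  count fT + count fF ∎
  where
  open ≡-Reasoning
  sT sF fT fF : Family (suc _)
  sT = shift y f ∘ (true ∷_)
  sF = shift y f ∘ (false ∷_)
  fT = f ∘ (true ∷_)
  fF = f ∘ (false ∷_)
  with-y without-y : Subset _ → Subset (suc _)
  with-y    Z = insertAt Z y true
  without-y Z = insertAt Z y false

  exchange : ∀ a b c d b′ c′ → b + c ≡ b′ + c′ → (a + b) + (c + d) ≡ (a + b′) + (c′ + d)
  exchange a b c d b′ c′ e = trans (assoc a b c d) (trans (cong (λ z → a + (z + d)) e) (sym (assoc a b′ c′ d)))
    where
    assoc : ∀ a b c d → (a + b) + (c + d) ≡ a + ((b + c) + d)
    assoc = solve-∀

  kept-with-0 : ∀ Z → sT (with-y Z) ≡ fT (with-y Z)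
  kept-with-0 Z rewrite insertAt-lookup Z y true = ∧-identityʳ _
  kept-without-0 : ∀ Z → sF (without-y Z) ≡ fF (without-y Z)
  kept-without-0 Z rewrite insertAt-lookup Z y false = ∨-identityʳ _

  swapped : ∀ a b → bit (a ∧ b) + bit (b ∨ a) ≡ bit a + bit b
  swapped true  true  = refl
  swapped true  false = refl
  swapped false true  = refl
  swapped false false = refl
  exchanged : ∀ Z → bit (sT (without-y Z)) + bit (sF (with-y Z)) ≡ bit (fT (without-y Z)) + bit (fF (with-y Z))
  exchanged Z rewrite insertAt-lookup Z y false | insertAt-lookup Z y true
                    | insertAt-[]≔ Z y false true | insertAt-[]≔ Z y true false =
    swapped (f (true ∷ without-y Z)) (f (false ∷ with-y Z))

weight : ∀ {n} → Family (suc n) → ℕ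
weight f = count (f ∘ (true ∷_))

weight-shift-< : ∀ {n} (y : Fin n) f X → f (true ∷ X) ≡ true → lookup X y ≡ false →
  f (false ∷ (X [ y ]≔ true)) ≡ false → weight (shift y f) < weight f
weight-shift-< y f X fX y∉X fX′ =
  count-mono-< (shift y f ∘ (true ∷_)) (f ∘ (true ∷_)) (λ _ e → proj₁ (∧-true⁻ e)) X dropped fX
  where
  dropped : shift y f (true ∷ X) ≡ false
  dropped rewrite fX | y∉X | fX′ = refl

shift-uniform : ∀ {n} {W : Subset n} {r} {f : Family (suc n)} y → lookup W y ≡ true →
  UniformFamily (true ∷ W) r f → UniformFamily (true ∷ W) r (shift y f)
shift-uniform {W = W} {r} {f} y y∈W F = record { within = within′ ; uniform = uniform′ }
  where
  open UniformFamily F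
  within′ : ∀ X → shift y f X ≡ true → X ⊆ᵇ (true ∷ W) ≡ true
  within′ (true ∷ X)  e = within _ (proj₁ (∧-true⁻ e))
  within′ (false ∷ X) e with ∨-true⁻ {f (false ∷ X)} e
  ... | inj₁ fX    = within _ fX
  ... | inj₂ moved = lookup-⊆ᵇ X W X⊆W
    where
    X⊆W : ∀ z → lookup X z ≡ true → lookup W z ≡ true
    X⊆W z z∈X with z ≟ y
    ... | yes refl = y∈W
    ... | no z≢y   = ⊆ᵇ-lookup (X [ y ]≔ false) W (within _ (proj₂ (∧-true⁻ moved))) z
                       (trans (lookup∘update′ z≢y X false) z∈X)
  uniform′ : ∀ X → shift y f X ≡ true → ∣ X ∣ ≡ r
  uniform′ (true ∷ X)  e = uniform _ (proj₁ (∧-true⁻ e))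
  uniform′ (false ∷ X) e with ∨-true⁻ {f (false ∷ X)} e
  ... | inj₁ fX    = uniform _ fX
  ... | inj₂ moved = trans (∣[]≔false∣ X y (proj₁ (∧-true⁻ moved))) (uniform _ (proj₂ (∧-true⁻ moved)))

shift-intersecting : ∀ {n} {W : Subset n} {r} {f : Family (suc n)} y → lookup W y ≡ true →
  IntersectingFamily (true ∷ W) r f → IntersectingFamily (true ∷ W) r (shift y f)
shift-intersecting {f = f} y y∈W F =
  record { uniformFamily = shift-uniform y y∈W uniformFamily ; intersecting = intersecting′ }
  where
  open IntersectingFamily F

  moved-meets-kept : ∀ X Y → lookup X y ≡ true → f (true ∷ (X [ y ]≔ false)) ≡ true → f (false ∷ Y) ≡ true →
    meets X Y ≡ true
  moved-meets-kept X Y y∈X fX′ fY with meets-elim (X [ y ]≔ false) Y (intersecting _ _ fX′ fY)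
  ... | z , z∈X′ , z∈Y with z ≟ y
  ... | yes refl = ⊥-elim (true≢false (trans (sym z∈X′) (lookup∘update y X false)))
  ... | no z≢y   = meets-intro X Y z (trans (sym (lookup∘update′ z≢y X false)) z∈X′) z∈Y

  with-0-meets-without-0 : ∀ X Y → shift y f (true ∷ X) ≡ true → shift y f (false ∷ Y) ≡ true → meets X Y ≡ true
  with-0-meets-without-0 X Y sX sY with ∧-true⁻ {f (true ∷ X)} sX | ∨-true⁻ {f (false ∷ Y)} sY
  ... | fX , _       | inj₁ fY = intersecting _ _ fX fY
  ... | _  , X-stays | inj₂ Y-moved with ∧-true⁻ Y-moved | ∨-true⁻ {lookup X y} X-stays
  ...   | y∈Y , _   | inj₁ y∈X  = meets-intro X Y y y∈X y∈Y
  ...   | y∈Y , fY′ | inj₂ fX′ with meets-elim (X [ y ]≔ true) (Y [ y ]≔ false) (intersecting _ _ fX′ fY′)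
  ...     | z , z∈X′ , z∈Y′ with z ≟ y
  ...       | yes refl = ⊥-elim (true≢false (trans (sym z∈Y′) (lookup∘update y Y false)))
  ...       | no z≢y   = meets-intro X Y z (trans (sym (lookup∘update′ z≢y X true)) z∈X′)
                                           (trans (sym (lookup∘update′ z≢y Y false)) z∈Y′)

  intersecting′ : ∀ X Y → shift y f X ≡ true → shift y f Y ≡ true → meets X Y ≡ true
  intersecting′ (true ∷ X)  (true ∷ Y)  sX sY = intersecting _ _ (proj₁ (∧-true⁻ sX)) (proj₁ (∧-true⁻ sY))
  intersecting′ (true ∷ X)  (false ∷ Y) sX sY = with-0-meets-without-0 X Y sX sY
  intersecting′ (false ∷ X) (true ∷ Y)  sX sY = meets-sym Y X (with-0-meets-without-0 Y X sY sX)
  intersecting′ (false ∷ X) (false ∷ Y) sX sY with ∨-true⁻ {f (false ∷ X)} sX | ∨-true⁻ {f (false ∷ Y)} sY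
  ... | inj₁ fX      | inj₁ fY      = intersecting _ _ fX fY
  ... | inj₂ X-moved | inj₂ Y-moved = meets-intro X Y y (proj₁ (∧-true⁻ X-moved)) (proj₁ (∧-true⁻ Y-moved))
  ... | inj₂ X-moved | inj₁ fY      = moved-meets-kept X Y (proj₁ (∧-true⁻ X-moved)) (proj₂ (∧-true⁻ {lookup X y} X-moved)) fY
  ... | inj₁ fX      | inj₂ Y-moved =
    meets-sym Y X (moved-meets-kept Y X (proj₁ (∧-true⁻ Y-moved)) (proj₂ (∧-true⁻ {lookup Y y} Y-moved)) fX)

Shifted : ∀ {n} → Subset n → Family (suc n) → Set
Shifted W f = ∀ X y → lookup W y ≡ true → f (true ∷ X) ≡ true → lookup X y ≡ false →
  f (false ∷ (X [ y ]≔ true)) ≡ true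

Unshifted : ∀ {n} → Subset n → Family (suc n) → Subset n → Fin n → Set
Unshifted W f X y =
  lookup W y ≡ true × f (true ∷ X) ≡ true × lookup X y ≡ false × f (false ∷ (X [ y ]≔ true)) ≡ false

unshifted? : ∀ {n} (W : Subset n) f X y → Dec (Unshifted W f X y)
unshifted? W f X y = lookup W y Bool.≟ true ×-dec f (true ∷ X) Bool.≟ true ×-dec lookup X y Bool.≟ false
                       ×-dec f (false ∷ (X [ y ]≔ true)) Bool.≟ false

∃-subset? : ∀ {n} {P : Subset n → Set} → (∀ X → Dec (P X)) → Dec (∃ P)
∃-subset? {zero}  P? = map′ ([] ,_) (λ { ([] , p) → p }) (P? [])
∃-subset? {suc n} P? = map′ (λ { (inj₁ (X , p)) → true ∷ X , p ; (inj₂ (X , p)) → false ∷ X , p })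
                            (λ { (true ∷ X , p) → inj₁ (X , p) ; (false ∷ X , p) → inj₂ (X , p) })
                            (∃-subset? (P? ∘ (true ∷_)) ⊎-dec ∃-subset? (P? ∘ (false ∷_)))

-- Each shift that changes f lowers its weight, so at most weight f shifts are needed.
shifted-version : ∀ fuel {n} (W : Subset n) {r} (f : Family (suc n)) → weight f ≤ fuel →
  IntersectingFamily (true ∷ W) r f →
  Σ (Family (suc n)) λ g → IntersectingFamily (true ∷ W) r g × Shifted W g × count g ≡ count f
shifted-version fuel {zero} W f _ F = f , F , (λ _ ()) , refl
shifted-version fuel {suc n} W f w≤fuel F with ∃-subset? (λ X → any? (unshifted? W f X))
... | no nothing-to-shift = f , F , shifted , refl
  where
  shifted : Shifted W f
  shifted X y y∈W fX y∉X with f (false ∷ (X [ y ]≔ true)) in fX′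
  ... | true  = refl
  ... | false = ⊥-elim (nothing-to-shift (X , y , y∈W , fX , y∉X , fX′))
... | yes (X , y , y∈W , fX , y∉X , fX′) with fuel | weight-shift-< y f X fX y∉X fX′
...   | zero      | w′<w = ⊥-elim (n≮0 (<-≤-trans w′<w w≤fuel))
...   | suc fuel′ | w′<w with shifted-version fuel′ W (shift y f) (≤-pred (<-≤-trans w′<w w≤fuel))
                                                (shift-intersecting y y∈W F)
...     | g , G , g-shifted , count-g≡ = g , G , g-shifted , trans count-g≡ (count-shift y f)

-- If G and H were disjoint, counting gives y ∈ W outside G ∪ H; by shiftedness H ∪ {y} is a member
-- avoiding 0, so it meets G ∪ {0}, hence G, at a point other than y: a point of G ∩ H.
shifted-link-intersecting : ∀ {n} (W : Subset n) s (g : Family (suc n)) → IntersectingFamily (true ∷ W) (suc s) g →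
  Shifted W g → 2 * s < ∣ W ∣ → ∀ G H → g (true ∷ G) ≡ true → g (true ∷ H) ≡ true → meets G H ≡ true
shifted-link-intersecting W s g F g-shifted 2s<∣W∣ G H gG gH with meets G H in G∩H
... | true  = refl
... | false with any? (λ y → lookup W y Bool.≟ true ×-dec lookup G y Bool.≟ false ×-dec lookup H y Bool.≟ false)
...   | no uncovered-none = ⊥-elim (<⇒≱ 2s<∣W∣ (≤-trans (∣∣-covered W G H covered) (≤-reflexive ∣G∣+∣H∣≡2s)))
  where
  open IntersectingFamily F
  covered : ∀ y → lookup W y ≡ true → (lookup G y ∨ lookup H y) ≡ true
  covered y y∈W with lookup G y in y∈?G | lookup H y in y∈?H
  ... | true  | _     = refl
  ... | false | true  = refl
  ... | false | false = ⊥-elim (uncovered-none (y , y∈W , y∈?G , y∈?H))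
  ∣G∣+∣H∣≡2s : ∣ G ∣ + ∣ H ∣ ≡ 2 * s
  ∣G∣+∣H∣≡2s = cong₂ _+_ (suc-injective (uniform _ gG)) (trans (suc-injective (uniform _ gH)) (sym (+-identityʳ s)))
...   | yes (y , y∈W , y∉G , y∉H)
  with meets-elim G (H [ y ]≔ true) (IntersectingFamily.intersecting F _ _ gG (g-shifted H y y∈W gH y∉H))
...     | z , z∈G , z∈H′ with z ≟ y
...       | yes refl = ⊥-elim (true≢false (trans (sym z∈G) y∉G))
...       | no z≢y   = ⊥-elim (true≢false (trans (sym (meets-intro G H z z∈G (trans (sym (lookup∘update′ z≢y H true)) z∈H′))) G∩H))

double-suc : ∀ s → 2 * suc s ≡ suc (suc s + s)
double-suc = solve-∀

≤-pred-double : ∀ s m → 2 * suc s ≤ suc (suc m) → 2 * s ≤ m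
≤-pred-double s m h = +-cancelˡ-≤ 2 (2 * s) m (subst (_≤ 2 + m) (*-suc 2 s) h)

2r∸1≤b<2r⇒b≡r+[r∸1] : ∀ s b → 2 * suc s ∸ 1 ≤ b → b < 2 * suc s → b ≡ suc s + s
2r∸1≤b<2r⇒b≡r+[r∸1] s b lower upper = ≤-antisym
  (≤-pred (subst (suc b ≤_) (double-suc s) upper))
  (subst (λ c → c ∸ 1 ≤ b) (double-suc s) lower)

erdős-ko-rado : ∀ {n} (W : Subset n) s (f : Family n) {m} → IntersectingFamily W (suc s) f →
  ∣ W ∣ ≡ suc m → 2 * suc s ≤ suc m → count f ≤ m choose s
erdős-ko-rado W zero f F _ _ =
  count≤1 f (λ X Y fX fY → meeting-singletons-≡ X Y (uniform X fX) (uniform Y fY) (intersecting X Y fX fY))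
  where open IntersectingFamily F
erdős-ko-rado [] (suc t) f F () _
erdős-ko-rado (false ∷ W) (suc t) f {m} F ∣W∣≡ h =
  subst (λ c → c + count (f ∘ (false ∷_)) ≤ m choose suc t) (sym (count-zero (f ∘ (true ∷_)) avoids-0))
    (erdős-ko-rado W (suc t) (f ∘ (false ∷_)) (tail-intersecting F) ∣W∣≡ h)
  where
  avoids-0 : ∀ X → f (true ∷ X) ≡ false
  avoids-0 X with f (true ∷ X) in fX
  ... | false = refl
  ... | true  = ⊥-elim (true≢false (sym (IntersectingFamily.within F _ fX)))
erdős-ko-rado (true ∷ W) (suc t) f {zero}  F _ (s≤s ())
erdős-ko-rado (true ∷ W) (suc t) f {suc m} F ∣W∣≡ h with shifted-version (weight f) W f ≤-refl F
... | g , G , g-shifted , count-g≡ = subst (_≤ suc m choose suc t) count-g≡ bound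
  where
  open IntersectingFamily G
  ∣W∣≡suc-m : ∣ W ∣ ≡ suc m
  ∣W∣≡suc-m = suc-injective ∣W∣≡
  2[t+1]≤m : 2 * suc t ≤ m
  2[t+1]≤m = ≤-pred-double (suc t) m h

  link-uniform : UniformFamily W (suc t) (g ∘ (true ∷_))
  link-uniform = record { within = within ∘ (true ∷_) ; uniform = λ X → suc-injective ∘ uniform (true ∷ X) }
  link : IntersectingFamily W (suc t) (g ∘ (true ∷_))
  link = record { uniformFamily = link-uniform
                ; intersecting  = shifted-link-intersecting W (suc t) g G g-shifted
                                    (subst (2 * suc t <_) (sym ∣W∣≡suc-m) (s≤s 2[t+1]≤m)) }
  rest : IntersectingFamily W (suc (suc t)) (g ∘ (false ∷_))
  rest = tail-intersecting G

  bound : count (g ∘ (true ∷_)) + count (g ∘ (false ∷_)) ≤ suc m choose suc t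
  bound with 2 * suc (suc t) ≤? suc m
  ... | yes h′ = +-mono-≤ (erdős-ko-rado W t _ link ∣W∣≡suc-m (m≤n⇒m≤1+n 2[t+1]≤m))
                          (erdős-ko-rado W (suc t) _ rest ∣W∣≡suc-m h′)
  ... | no  h′ = begin
    count (g ∘ (true ∷_)) + count (g ∘ (false ∷_))  ≡⟨ +-comm (count (g ∘ (true ∷_))) _ ⟩
    count (g ∘ (false ∷_)) + count (g ∘ (true ∷_))  ≤⟨ cross-intersecting-bound W (suc (suc t)) (suc t) _ _ ∣W∣≡2t+3
                                                          (IntersectingFamily.uniformFamily rest) link-uniform
                                                          (λ X Y → intersecting (false ∷ X) (true ∷ Y)) ⟩
    ∣ W ∣ choose suc t                              ≡⟨ cong (_choose suc t) ∣W∣≡suc-m ⟩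
    suc m choose suc t                              ∎
    where
    open ≤-Reasoning
    ∣W∣≡2t+3 : ∣ W ∣ ≡ suc (suc t) + suc t
    ∣W∣≡2t+3 = subst (_≡ suc (suc t) + suc t) (sym ∣W∣≡suc-m)
      (2r∸1≤b<2r⇒b≡r+[r∸1] (suc t) (suc m) (∸-monoˡ-≤ 1 h) (≰⇒> h′))

intersecting-count≤ : ∀ {n} (W : Subset n) s (f : Family n) → IntersectingFamily W (suc s) f →
  2 * suc s ∸ 1 ≤ ∣ W ∣ → count f ≤ ∣ W ∣ choose s
intersecting-count≤ W s f F lower with 2 * suc s ≤? ∣ W ∣
... | yes 2r≤∣W∣ = via-erdős-ko-rado ∣ W ∣ refl 2r≤∣W∣
  where
  via-erdős-ko-rado : ∀ b → ∣ W ∣ ≡ b → 2 * suc s ≤ b → count f ≤ b choose s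
  via-erdős-ko-rado (suc m) ∣W∣≡ 2r≤b = ≤-trans (erdős-ko-rado W s f F ∣W∣≡ 2r≤b) (choose-mono-suc m s)
... | no 2r≰∣W∣ = begin
  count f                    ≡⟨ sym (+-identityʳ (count f)) ⟩
  count f + 0                ≡⟨ cong (count f +_) (sym (count-zero none (λ _ → refl))) ⟩
  count f + count none       ≤⟨ cross-intersecting-bound W (suc s) s f none ∣W∣≡2s+1 (IntersectingFamily.uniformFamily F)
                                  (record { within = λ _ () ; uniform = λ _ () }) (λ _ _ _ ()) ⟩
  ∣ W ∣ choose s             ∎
  where
  open ≤-Reasoning
  none : Family _
  none _ = false
  ∣W∣≡2s+1 : ∣ W ∣ ≡ suc s + s
  ∣W∣≡2s+1 = 2r∸1≤b<2r⇒b≡r+[r∸1] s ∣ W ∣ lower (≰⇒> 2r≰∣W∣)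

-- Partitions and colour classes

does-true⁻ : ∀ {A : Set} (a? : Dec A) → does a? ≡ true → A
does-true⁻ (yes a) _ = a

lookup-part : ∀ {k n} (S : Partition k n) l x → lookup (part S l) x ≡ does (S x ≟ l)
lookup-part S l x = lookup∘tabulate (λ x → does (S x ≟ l)) x

parts-disjoint : ∀ {k n} (S : Partition k n) {a b} x → a ≢ b →
  lookup (part S a) x ≡ true → lookup (part S b) x ≡ true → ⊥
parts-disjoint S {a} {b} x a≢b x∈Sa x∈Sb rewrite lookup-part S a x | lookup-part S b x =
  a≢b (trans (sym (does-true⁻ (S x ≟ a) x∈Sa)) (does-true⁻ (S x ≟ b) x∈Sb))

lookup-merged-part : ∀ {k n} (S : Partition k n) {i j} x → i ≢ j →
  lookup (part (merge S i j) i) x ≡ (lookup (part S i) x ∨ lookup (part S j) x)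
lookup-merged-part S {i} {j} x i≢j rewrite lookup-part (merge S i j) i x | lookup-part S i x | lookup-part S j x
  with S x ≟ j
... | yes _ rewrite dec-true (i ≟ i) refl = sym (∨-zeroʳ _)
... | no  _ = sym (∨-identityʳ _)

merged-part-⊇ : ∀ {k n} (S : Partition k n) {i j l} x → l ≢ j →
  lookup (part S l) x ≡ true → lookup (part (merge S i j) l) x ≡ true
merged-part-⊇ S {i} {j} {l} x l≢j x∈Sl rewrite lookup-part (merge S i j) l x | lookup-part S l x with S x ≟ j
... | yes Sx≡j = ⊥-elim (l≢j (trans (sym (does-true⁻ (S x ≟ l) x∈Sl)) Sx≡j))
... | no  _    = x∈Sl

∣merged-part∣ : ∀ {k n} (S : Partition k n) {i j} → i ≢ j → ∣ part (merge S i j) i ∣ ≡ ∣ part S i ∣ + ∣ part S j ∣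
∣merged-part∣ S {i} {j} i≢j = ∣∪∣ (part (merge S i j) i) (part S i) (part S j) (λ x → lookup-merged-part S x i≢j) disjoint
  where
  disjoint : ∀ x → (lookup (part S i) x ∧ lookup (part S j) x) ≡ false
  disjoint x with lookup (part S i) x in x∈Si | lookup (part S j) x in x∈Sj
  ... | true  | true  = ⊥-elim (parts-disjoint S x i≢j x∈Si x∈Sj)
  ... | true  | false = refl
  ... | false | _     = refl

module _ {k n : ℕ} where

  colourClass : Fin k → List (Vtx k n) → List (Subset n)
  colourClass c [] = []
  colourClass c ((l , X) ∷ L) with l ≟ c
  ... | yes _ = X ∷ colourClass c L
  ... | no  _ = colourClass c L

  otherColours : Fin k → Fin k → List (Vtx k n) → List (Vtx k n)
  otherColours i j [] = []
  otherColours i j ((l , X) ∷ L) with l ≟ i | l ≟ j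
  ... | yes _ | _     = otherColours i j L
  ... | no  _ | yes _ = otherColours i j L
  ... | no  _ | no  _ = (l , X) ∷ otherColours i j L

  length-colourClasses : ∀ {i j} → i ≢ j → (L : List (Vtx k n)) →
    length L ≡ length (colourClass i L) + length (colourClass j L) + length (otherColours i j L)
  length-colourClasses i≢j [] = refl
  length-colourClasses {i} {j} i≢j ((l , X) ∷ L) with l ≟ i | l ≟ j | length-colourClasses i≢j L
  ... | yes refl | yes refl | _  = ⊥-elim (i≢j refl)
  ... | yes _    | no  _    | eq = cong suc eq
  ... | no  _    | yes _    | eq =
    trans (cong suc eq) (cong (_+ length (otherColours i j L)) (sym (+-suc (length (colourClass i L)) _)))
  ... | no  _    | no  _    | eq = trans (cong suc eq) (sym (+-suc _ _))

  ∈-colourClass⁻ : ∀ {c} (L : List (Vtx k n)) {X} → X ∈ colourClass c L → (c , X) ∈ L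
  ∈-colourClass⁻ {c} ((l , Y) ∷ L) X∈ with l ≟ c
  ∈-colourClass⁻ ((l , Y) ∷ L) (here refl) | yes refl = here refl
  ∈-colourClass⁻ ((l , Y) ∷ L) (there X∈) | yes _    = there (∈-colourClass⁻ L X∈)
  ∈-colourClass⁻ ((l , Y) ∷ L) X∈         | no  _    = there (∈-colourClass⁻ L X∈)

  colourClass-unique : ∀ c {L : List (Vtx k n)} → Unique L → Unique (colourClass c L)
  colourClass-unique c {[]} [] = []
  colourClass-unique c {(l , Y) ∷ L} (Y≢L ∷ L!) with l ≟ c
  ... | yes refl = All.tabulate (λ X∈ Y≡X → All.lookup Y≢L (∈-colourClass⁻ L X∈) (cong (l ,_) Y≡X))
                   ∷ colourClass-unique c L!
  ... | no  _    = colourClass-unique c L!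

  ∈-otherColours⁻ : ∀ {i j} (L : List (Vtx k n)) {v} → v ∈ otherColours i j L → v ∈ L × proj₁ v ≢ i × proj₁ v ≢ j
  ∈-otherColours⁻ {i} {j} ((l , X) ∷ L) v∈ with l ≟ i | l ≟ j
  ∈-otherColours⁻ ((l , X) ∷ L) v∈          | yes _ | _     = map₁ there (∈-otherColours⁻ L v∈)
  ∈-otherColours⁻ ((l , X) ∷ L) v∈          | no  _ | yes _ = map₁ there (∈-otherColours⁻ L v∈)
  ∈-otherColours⁻ ((l , X) ∷ L) (here refl) | no  p | no  q = here refl , p , q
  ∈-otherColours⁻ ((l , X) ∷ L) (there v∈)  | no  _ | no  _ = map₁ there (∈-otherColours⁻ L v∈)

  otherColours-All : ∀ {P : Vtx k n → Set} i j {L} → All P L → All P (otherColours i j L)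
  otherColours-All i j {[]} [] = []
  otherColours-All i j {(l , X) ∷ L} (p ∷ ps) with l ≟ i | l ≟ j
  ... | yes _ | _     = otherColours-All i j ps
  ... | no  _ | yes _ = otherColours-All i j ps
  ... | no  _ | no  _ = p ∷ otherColours-All i j ps

  otherColours-AllPairs : ∀ {R : Vtx k n → Vtx k n → Set} i j {L} → AllPairs R L → AllPairs R (otherColours i j L)
  otherColours-AllPairs i j {[]} [] = []
  otherColours-AllPairs i j {(l , X) ∷ L} (p ∷ ps) with l ≟ i | l ≟ j
  ... | yes _ | _     = otherColours-AllPairs i j ps
  ... | no  _ | yes _ = otherColours-AllPairs i j ps
  ... | no  _ | no  _ = otherColours-All i j p ∷ otherColours-AllPairs i j ps

AllPairs-lookup : ∀ {A : Set} {R : A → A → Set} {L : List A} {u v} → AllPairs R L → u ∈ L → v ∈ L → u ≢ v →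
  R u v ⊎ R v u
AllPairs-lookup (_  ∷ _)   (here refl) (here refl) u≢v = ⊥-elim (u≢v refl)
AllPairs-lookup (Ru ∷ _)   (here refl) (there v∈)  _   = inj₁ (All.lookup Ru v∈)
AllPairs-lookup (Rv ∷ _)   (there u∈)  (here refl) _   = inj₂ (All.lookup Rv u∈)
AllPairs-lookup (_  ∷ RL)  (there u∈)  (there v∈)  u≢v = AllPairs-lookup RL u∈ v∈ u≢v

All⇒AllPairs : ∀ {A : Set} {P : A → Set} {R : A → A → Set} → (∀ {u v} → P u → P v → R u v) →
  ∀ {L} → All P L → AllPairs R L
All⇒AllPairs R-of-P []       = []
All⇒AllPairs R-of-P (p ∷ ps) = All.map (R-of-P p) ps ∷ All⇒AllPairs R-of-P ps

¬Adj⇒meets : ∀ {k n} (c : Fin k) (X Y : Subset n) → ¬ Adj (c , X) (c , Y) → meets X Y ≡ true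
¬Adj⇒meets c X Y ¬adj with meets X Y in X∩Y
... | true  = refl
... | false = ⊥-elim (¬adj (inj₁ (refl , disjoint)))
  where
  disjoint : Empty (X ∩ Y)
  disjoint (y , y∈X∩Y) with x∈p∩q⁻ X Y y∈X∩Y
  ... | y∈X , y∈Y = true≢false (trans (sym (meets-intro X Y y ([]=⇒lookup y∈X) ([]=⇒lookup y∈Y))) X∩Y)

colourFamily : ∀ {k n} → Fin k → List (Vtx k n) → Family n
colourFamily c I X = does (Any.any? (≡-dec Bool._≟_ X) (colourClass c I))

colourFamily-intersecting : ∀ {k n r} {S : Partition k n} {I} → AdmissibleIndep (suc r) S I →
  ∀ c → IntersectingFamily (part S c) (suc r) (colourFamily c I)
colourFamily-intersecting {S = S} {I} (_ , sizes , inParts , independent) c =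
  record { uniformFamily = record { within = within ; uniform = uniform } ; intersecting = intersecting }
  where
  vertex : ∀ X → colourFamily c I X ≡ true → (c , X) ∈ I
  vertex X e = ∈-colourClass⁻ I (does-true⁻ (Any.any? (≡-dec Bool._≟_ X) (colourClass c I)) e)
  within : ∀ X → colourFamily c I X ≡ true → X ⊆ᵇ part S c ≡ true
  within X e = ⊆⇒⊆ᵇ X (part S c) (All.lookup inParts (vertex X e))
  uniform : ∀ X → colourFamily c I X ≡ true → ∣ X ∣ ≡ suc _
  uniform X e = All.lookup sizes (vertex X e)
  intersecting : ∀ X Y → colourFamily c I X ≡ true → colourFamily c I Y ≡ true → meets X Y ≡ true
  intersecting X Y eX eY with ≡-dec Bool._≟_ X Y
  ... | yes refl = meets-self X (uniform X eX)
  ... | no  X≢Y with AllPairs-lookup independent (vertex X eX) (vertex Y eY) (X≢Y ∘ cong proj₂)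
  ...   | inj₁ ¬adj = ¬Adj⇒meets c X Y ¬adj
  ...   | inj₂ ¬adj = meets-sym Y X (¬Adj⇒meets c Y X ¬adj)

length-colourClass≤ : ∀ {k n} c (I : List (Vtx k n)) → Unique I → length (colourClass c I) ≤ count (colourFamily c I)
length-colourClass≤ c I I! = length≤count (colourFamily c I) (colourClass-unique c I!)
  (All.tabulate (λ {X} X∈ → dec-true (Any.any? (≡-dec Bool._≟_ X) (colourClass c I)) X∈))

module Recolouring {k n r} {S : Partition k n} {I : List (Vtx k n)} (admissible : AdmissibleIndep r S I)
                   {i j : Fin k} (i≢j : i ≢ j) {x : Fin n} (x∈U : lookup (part (merge S i j) i) x ≡ true) where

  S′ : Partition k n
  S′ = merge S i j

  U : Subset n
  U = part S′ i

  starClass : List (Subset n)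
  starClass = members (star U r x)

  recoloured : List (Vtx k n)
  recoloured = otherColours i j I ++ map (i ,_) starClass

  length-recoloured : length recoloured ≡ length (otherColours i j I) + count (star U r x)
  length-recoloured = begin
    length recoloured                                             ≡⟨ length-++ (otherColours i j I) ⟩
    length (otherColours i j I) + length (map (i ,_) starClass)   ≡⟨ cong (length (otherColours i j I) +_)
                                                                       (trans (length-map (i ,_) starClass) (length-members (star U r x))) ⟩
    length (otherColours i j I) + count (star U r x)              ∎
    where open ≡-Reasoning

  recoloured-no-smaller : length (colourClass i I) + length (colourClass j I) ≤ count (star U r x) →
    length I ≤ length recoloured
  recoloured-no-smaller star-large = begin
    length I                                                                           ≡⟨ length-colourClasses i≢j I ⟩
    length (colourClass i I) + length (colourClass j I) + length (otherColours i j I)  ≤⟨ +-monoˡ-≤ _ star-large ⟩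
    count (star U r x) + length (otherColours i j I)                                   ≡⟨ +-comm (count (star U r x)) _ ⟩
    length (otherColours i j I) + count (star U r x)                                   ≡⟨ sym length-recoloured ⟩
    length recoloured                                                                  ∎
    where open ≤-Reasoning

  private
    I! = proj₁ admissible
    sizes = proj₁ (proj₂ admissible)
    inParts = proj₁ (proj₂ (proj₂ admissible))
    independent = proj₂ (proj₂ (proj₂ admissible))

    star⁻ : ∀ X → star U r x X ≡ true → ∣ X ∣ ≡ r × X ⊆ U × lookup X x ≡ true
    star⁻ X e with ∧-true⁻ {∣ X ∣ ≡ᵇ r} e
    ... | ∣X∣≡ᵇr , rest with ∧-true⁻ {X ⊆ᵇ U} rest
    ...   | X⊆U , x∈X = ≡ᵇ-true⁻ _ _ ∣X∣≡ᵇr , ⊆ᵇ⇒⊆ X U X⊆U , x∈X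

    other⁻ : ∀ {v} → v ∈ otherColours i j I → proj₁ v ≢ i × proj₂ v ⊆ part S′ (proj₁ v)
    other⁻ {l , X} v∈ with ∈-otherColours⁻ I v∈
    ... | v∈I , l≢i , l≢j = l≢i , λ {y} y∈X →
      lookup⇒[]= y (part S′ l) (merged-part-⊇ S y l≢j ([]=⇒lookup (All.lookup inParts v∈I y∈X)))

    unique : Unique recoloured
    unique = Unique.++⁺ (otherColours-AllPairs i j I!) (Unique.map⁺ (λ { refl → refl }) (members-unique (star U r x)))
                        (λ (v∈other , v∈star) → let (_ , _ , v≡) = ∈-map⁻ (i ,_) v∈star in proj₁ (other⁻ v∈other) (cong proj₁ v≡))

    star-pairwise : AllPairs (λ X Y → ¬ Adj (i , X) (i , Y)) starClass
    star-pairwise = All⇒AllPairs non-adjacent (members-sound (star U r x))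
      where
      non-adjacent : ∀ {X Y} → star U r x X ≡ true → star U r x Y ≡ true → ¬ Adj (i , X) (i , Y)
      non-adjacent {X} {Y} X∈ Y∈ (inj₁ (_ , disjoint)) =
        disjoint (x , x∈p∩q⁺ (lookup⇒[]= x X (proj₂ (proj₂ (star⁻ X X∈))) , lookup⇒[]= x Y (proj₂ (proj₂ (star⁻ Y Y∈)))))
      non-adjacent _ _ (inj₂ (i≢i , _)) = i≢i refl

    other-star : ∀ {v} → v ∈ otherColours i j I → ∀ {Z} → star U r x Z ≡ true → ¬ Adj v (i , Z)
    other-star v∈ _ (inj₁ (l≡i , _)) = proj₁ (other⁻ v∈) l≡i
    other-star {l , X} v∈ {Z} Z∈ (inj₂ (_ , y , y∈X∩Z)) with x∈p∩q⁻ X Z y∈X∩Z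
    ... | y∈X , y∈Z = parts-disjoint S′ y (proj₁ (other⁻ v∈))
                        ([]=⇒lookup (proj₂ (other⁻ v∈) y∈X)) ([]=⇒lookup (proj₁ (proj₂ (star⁻ Z Z∈)) y∈Z))

  recoloured-admissible : AdmissibleIndep r S′ recoloured
  recoloured-admissible =
      unique
    , All.++⁺ (otherColours-All i j sizes) (All.map⁺ (All.map (λ {X} → proj₁ ∘ star⁻ X) (members-sound (star U r x))))
    , All.++⁺ (All.tabulate (proj₂ ∘ other⁻)) (All.map⁺ (All.map (λ {X} → proj₁ ∘ proj₂ ∘ star⁻ X) (members-sound (star U r x))))
    , AllPairs.++⁺ (otherColours-AllPairs i j independent) (AllPairs.map⁺ star-pairwise)
                   (All.tabulate (λ v∈ → All.map⁺ (All.map (other-star v∈) (members-sound (star U r x)))))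

pred-witness : ∀ {m b} → suc m ≤ b → ∃ λ b′ → b ≡ suc b′
pred-witness {b = suc b} _ = b , refl

lemma4p23 : (r k n : ℕ) → 2 ≤ r → 1 ≤ k → 2 * r ≤ n →
    (S : Partition k n) →
    ∃₂ (λ a b → a ≢ b × Nonempty (part S a) × Nonempty (part S b)) →
    ((l : Fin k) → Nonempty (part S l) → 2 * r ∸ 1 ≤ ∣ part S l ∣) →
    (i : Fin k) → 2 * r ≤ ∣ part S i ∣ →
    (j : Fin k) → j ≢ i → Nonempty (part S j) →
    αLe r S (merge S i j)
lemma4p23 (suc zero) _ _ (s≤s ())
lemma4p23 (suc (suc s)) _ _ _ _ _ S _ large-parts i 2r≤∣Sᵢ∣ j j≢i Sⱼ≢∅ I admissible
  with pred-witness 2r≤∣Sᵢ∣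
... | a′ , ∣Sᵢ∣≡ = recoloured , recoloured-admissible , recoloured-no-smaller star-large
  where
  i≢j : i ≢ j
  i≢j = j≢i ∘ sym
  b = ∣ part S j ∣
  x = proj₁ (nonempty-lookup (part S i) ∣Sᵢ∣≡)
  x∈U : lookup (part (merge S i j) i) x ≡ true
  x∈U = trans (lookup-merged-part S x i≢j) (cong (_∨ lookup (part S j) x) (proj₂ (nonempty-lookup (part S i) ∣Sᵢ∣≡)))
  open Recolouring {S = S} admissible i≢j x∈U

  classᵢ : length (colourClass i I) ≤ a′ choose suc s
  classᵢ = ≤-trans (length-colourClass≤ i I (proj₁ admissible))
    (erdős-ko-rado (part S i) (suc s) _ (colourFamily-intersecting {S = S} admissible i) ∣Sᵢ∣≡ (subst (_ ≤_) ∣Sᵢ∣≡ 2r≤∣Sᵢ∣))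
  classⱼ : length (colourClass j I) ≤ b choose suc s
  classⱼ = ≤-trans (length-colourClass≤ j I (proj₁ admissible))
    (intersecting-count≤ (part S j) (suc s) _ (colourFamily-intersecting {S = S} admissible j) (large-parts j Sⱼ≢∅))

  ∣U∣≡ : ∣ U ∣ ≡ suc (a′ + b)
  ∣U∣≡ = trans (∣merged-part∣ S i≢j) (cong (_+ b) ∣Sᵢ∣≡)

  star-large : length (colourClass i I) + length (colourClass j I) ≤ count (star U (suc (suc s)) x)
  star-large = begin
    length (colourClass i I) + length (colourClass j I)  ≤⟨ +-mono-≤ classᵢ classⱼ ⟩
    a′ choose suc s + b choose suc s                     ≤⟨ choose-superadditive a′ b s ⟩
    (a′ + b) choose suc s                                ≡⟨ sym (count-star U (suc s) x x∈U ∣U∣≡) ⟩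
    count (star U (suc (suc s)) x)                       ∎
    where open ≤-Reasoning
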